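{- Let $L$ be any of the fifteen logics of the modal cube and $\mathcal M_L$ its Nmatrix. For every level-valuation $v\in L(\mathcal M_L)$ and every set of formulas $\Lambda$ closed under subformulas, the restriction $v|_\Lambda$ of $v$ to $\Lambda$ is a partial level-valuation.
   Context: Syntax and logics. Formulas: $\alpha ::= p \mid \bot \mid \alpha\to\alpha \mid \Box\alpha$; $\mathrm{For}$ is the set of formulas; $\neg\alpha:=\alpha\to\bot$, $\Diamond\alpha:=\neg\Box\neg\alpha$. $\mathbf K$: classical propositional axioms, (k) $\Box(\alpha\to\beta)\to(\Box\alpha\to\Box\beta)$, modus ponens, necessitation. Axiom schemes (D) $\Box\alpha\to\Diamond\alpha$, (T) $\Box\alpha\to\alpha$, (B) $\alpha\to\Box\Diamond\alpha$, (4) $\Box\alpha\to\Box\Box\alpha$, (5) $\Diamond\alpha\to\Box\Diamond\alpha$. The modal cube: $\mathbf K,\mathbf{KB},\mathbf{K4},\mathbf{K5},\mathbf{K45},\mathbf{KD},\mathbf{KDB},\mathbf{KD4},\mathbf{KD5},\mathbf{KD45},\mathbf{KT},\mathbf{KTB},\mathbf{S4}=\mathbf{KT4},\mathbf{S5}=\mathbf{KTB45},\mathbf{KB5}=\mathbf{KB45}$. Truth values $\mathbf{F},\mathbf{f},\mathbf{f}_2,\mathbf{f}_3,\mathbf{t}_3,\mathbf{t}_2,\mathbf{t},\mathbf{T}$. Distinguished sets: $\mathcal D=\{\mathbf T,\mathbf t,\mathbf t_2,\mathbf t_3\}$ (designated), $N=\{\mathbf T,\mathbf t_2,\mathbf f_3,\mathbf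 f_2\}$, $I=\{\mathbf F,\mathbf f_2,\mathbf t_3,\mathbf t_2\}$, $P=\{\mathbf T,\mathbf t,\mathbf f_3,\mathbf f\}$, $PN=\{\mathbf F,\mathbf f,\mathbf t_3,\mathbf t\}$. Nmatrix $\mathcal M_L$. Values $V(L)$: all eight values for $\mathbf K,\mathbf{KB},\mathbf{K4},\mathbf{K5},\mathbf{K45}$; $\{\mathbf F,\mathbf f,\mathbf f_2,\mathbf t_2,\mathbf t,\mathbf T\}$ for $\mathbf{KB5}$; $\{\mathbf F,\mathbf f,\mathbf f_3,\mathbf t_3,\mathbf t,\mathbf T\}$ for $\mathbf{KD},\mathbf{KDB},\mathbf{KD4},\mathbf{KD5},\mathbf{KD45}$; $\{\mathbf F,\mathbf f,\mathbf t,\mathbf T\}$ for $\mathbf{KT},\mathbf{KTB},\mathbf{S4},\mathbf{S5}$. $\tilde\bot=\{\mathbf F,\mathbf f_2\}$. $\tilde\to(x,y)$, restricted to arguments in $V(L)$, listed for $y=\mathbf F,\mathbf f,\mathbf f_2,\mathbf f_3,\mathbf t_3,\mathbf t_2,\mathbf t,\mathbf T$: $x=\mathbf F$: $\{\mathbf T\}$ for all $y$; $x=\mathbf f$: $\{\mathbf t\},\{\mathbf T,\mathbf t\},\{\mathbf t_2\},\{\mathbf T\},\{\mathbf t\},\{\mathbf T\},\{\mathbf T,\mathbf t\},\{\mathbf T\}$; $x=\mathbf f_2$ and $x=\mathbf f_3$: $\{\mathbf t_3\},\{\mathbf t\},\{\mathbf t_2\},\{\mathbf T\},\{\mathbf t_3\},\{\mathbf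 t_2\},\{\mathbf t\},\{\mathbf T\}$; $x=\mathbf t_3$: $\{\mathbf f_3\}$ for $y\in\{\mathbf F,\mathbf f,\mathbf f_2,\mathbf f_3\}$, $\{\mathbf T\}$ otherwise; $x=\mathbf t_2$: $\{\mathbf F\},\{\mathbf f\},\{\mathbf f_2\},\{\mathbf f_3\},\{\mathbf t_3\},\{\mathbf t_2\},\{\mathbf t_3\},\{\mathbf T\}$; $x=\mathbf t$: $\{\mathbf f\},\{\mathbf f,\mathbf f_3\},\{\mathbf f_3\},\{\mathbf f_3\},\{\mathbf t\},\{\mathbf T\},\{\mathbf T,\mathbf t\},\{\mathbf T\}$; $x=\mathbf T$: $\{\mathbf F\},\{\mathbf f\},\{\mathbf f_2\},\{\mathbf f_3\},\{\mathbf t_3\},\{\mathbf t_2\},\{\mathbf t\},\{\mathbf T\}$. $\tilde\Box$ (argument $\mapsto$ output): $\mathbf K$: $\mathbf F,\mathbf f,\mathbf t_3,\mathbf t\mapsto\{\mathbf F,\mathbf f,\mathbf f_3\}$; $\mathbf f_2,\mathbf t_2\mapsto\{\mathbf t_2\}$; $\mathbf f_3,\mathbf T\mapsto\{\mathbf T,\mathbf t,\mathbf t_3\}$. $\mathbf{KB}$: $\mathbf F,\mathbf f\mapsto\{\mathbf F\}$; $\mathbf f_2,\mathbf t_2\mapsto\{\mathbf t_2\}$; $\mathbf f_3\mapsto\{\mathbf t_3\}$; $\mathbf t_3,\mathbf t\mapsto\{\mathbf F,\mathbf f,\mathbf f_3\}$; $\mathbf T\mapsto\{\mathbf T,\mathbf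 t,\mathbf t_3\}$. $\mathbf{K4}$: $\mathbf F,\mathbf f,\mathbf t_3,\mathbf t\mapsto\{\mathbf F,\mathbf f,\mathbf f_3\}$; $\mathbf f_2,\mathbf t_2\mapsto\{\mathbf t_2\}$; $\mathbf f_3,\mathbf T\mapsto\{\mathbf T\}$. $\mathbf{K5}$: $\mathbf F,\mathbf f,\mathbf t_3,\mathbf t\mapsto\{\mathbf F\}$; $\mathbf f_2,\mathbf t_2\mapsto\{\mathbf t_2\}$; $\mathbf f_3,\mathbf T\mapsto\{\mathbf T,\mathbf t_3\}$. $\mathbf{K45}$: $\mathbf F,\mathbf f,\mathbf t_3,\mathbf t\mapsto\{\mathbf F\}$; $\mathbf f_2,\mathbf t_2\mapsto\{\mathbf t_2\}$; $\mathbf f_3,\mathbf T\mapsto\{\mathbf T\}$. $\mathbf{KB5}$: $\mathbf F,\mathbf f,\mathbf t\mapsto\{\mathbf F\}$; $\mathbf f_2,\mathbf t_2\mapsto\{\mathbf t_2\}$; $\mathbf T\mapsto\{\mathbf T\}$. $\mathbf{KD}$: $\mathbf F,\mathbf f,\mathbf t_3,\mathbf t\mapsto\{\mathbf F,\mathbf f,\mathbf f_3\}$; $\mathbf f_3,\mathbf T\mapsto\{\mathbf T,\mathbf t,\mathbf t_3\}$. $\mathbf{KDB}$: $\mathbf F,\mathbf f\mapsto\{\mathbf F\}$; $\mathbf f_3\mapsto\{\mathbf t_3\}$; $\mathbf t_3,\mathbf t\mapsto\{\mathbf F,\mathbf f,\mathbf f_3\}$; $\mathbf T\mapsto\{\mathbf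 T,\mathbf t,\mathbf t_3\}$. $\mathbf{KD4}$: $\mathbf F,\mathbf t_3\mapsto\{\mathbf F\}$; $\mathbf f,\mathbf t\mapsto\{\mathbf F,\mathbf f,\mathbf f_3\}$; $\mathbf f_3,\mathbf T\mapsto\{\mathbf T\}$. $\mathbf{KD5}$: $\mathbf F,\mathbf f,\mathbf t_3,\mathbf t\mapsto\{\mathbf F\}$; $\mathbf f_3,\mathbf T\mapsto\{\mathbf T,\mathbf t_3\}$. $\mathbf{KD45}$: $\mathbf F,\mathbf f,\mathbf t_3,\mathbf t\mapsto\{\mathbf F\}$; $\mathbf f_3,\mathbf T\mapsto\{\mathbf T\}$. $\mathbf{KT}$: $\mathbf F\mapsto\{\mathbf F\}$; $\mathbf f,\mathbf t\mapsto\{\mathbf F,\mathbf f\}$; $\mathbf T\mapsto\{\mathbf T,\mathbf t\}$. $\mathbf{KTB}$: $\mathbf F,\mathbf f\mapsto\{\mathbf F\}$; $\mathbf t\mapsto\{\mathbf F,\mathbf f\}$; $\mathbf T\mapsto\{\mathbf T,\mathbf t\}$. $\mathbf{S4}$: $\mathbf F\mapsto\{\mathbf F\}$; $\mathbf f,\mathbf t\mapsto\{\mathbf F,\mathbf f\}$; $\mathbf T\mapsto\{\mathbf T\}$. $\mathbf{S5}$: $\mathbf F,\mathbf f,\mathbf t\mapsto\{\mathbf F\}$; $\mathbf T\mapsto\{\mathbf T\}$. Partial valuations: for $\Lambda$ closed under subformulas, $[\Lambda\to V]_{\mathcal M_L}$ is the set of maps $v:\Lambda\to V(L)$ with $v(\bot)\in\tilde\bot$,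 $v(\beta\to\gamma)\in\tilde\to(v(\beta),v(\gamma))$, $v(\Box\beta)\in\tilde\Box(v(\beta))$ whenever these formulas lie in $\Lambda$. A valuation is such a map with $\Lambda=\mathrm{For}$; $\mathrm{Val}(\mathcal M_L)$ is the set of valuations. Level valuations: $L_0(\mathcal M_L)$ is the set of $v\in\mathrm{Val}(\mathcal M_L)$ such that, if $v(\beta)\in\{\mathbf f_2,\mathbf t_2\}$ for some $\beta$, then $v(\gamma)\in\{\mathbf f_2,\mathbf t_2\}$ for all $\gamma$. $L_{n+1}(\mathcal M_L)=\{v\in L_n(\mathcal M_L)\mid$ for all $\beta$, if $w(\beta)\in\mathcal D$ for every $w\in L_n(\mathcal M_L)$, then $v(\beta)\in\{\mathbf T,\mathbf t_2\}\}$. The level-valuations are $L(\mathcal M_L)=\bigcap_{n\ge0}L_n(\mathcal M_L)$. Models: a pre-model on $\Lambda$ is a pair $\langle\Pi,R\rangle$ with $\Pi\subseteq[\Lambda\to V]_{\mathcal M_L}$ and $R\subseteq\Pi\times\Pi$ such that for all $v\in\Pi$, $\beta\in\Lambda$: if $v(\beta)\in P$ there is $w\in\Pi$ with $vRw$ and $w(\beta)\in\mathcal D$; if $v(\beta)\in PN$ there is $w\in\Pi$ with $vRw$ and $w(\beta)\notin\mathcal D$. A $\mathbf K$-model is a pre-model such that whenever $vRw$: $v(\beta)\in N\Rightarrow w(\beta)\in\mathcal D$ and $v(\beta)\in I\Rightarrow w(\beta)\notin\mathcal D$. An $L$-model is a $\mathbf K$-model satisfying, for each axiom scheme among (T),(D),(B),(4),(5)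 that holds in $L$, the following conditions for all $v,w,w'\in\Pi$, $\beta\in\Lambda$: (T): $v(\beta)\in N\Rightarrow v(\beta)\in\mathcal D$, and $v(\beta)\in I\Rightarrow v(\beta)\notin\mathcal D$; (D): $v(\beta)\in N\Rightarrow v(\beta)\in P$, and $v(\beta)\in I\Rightarrow v(\beta)\in PN$; (B): if $vRw$, then $v(\beta)\in\mathcal D\Rightarrow w(\beta)\in P$ and $v(\beta)\notin\mathcal D\Rightarrow w(\beta)\in PN$; (4): if $vRw$, then $v(\beta)\in N\Rightarrow w(\beta)\in N$ and $v(\beta)\in I\Rightarrow w(\beta)\in I$; (5): if $vRw$, then $v(\beta)\in P\Rightarrow w(\beta)\in P$ and $v(\beta)\in PN\Rightarrow w(\beta)\in PN$; moreover if $v(\beta),w(\beta)\in N$, $vRw$ and ($vRw'$ or $wRw'$) then $w'(\beta)\in N$, and likewise with $I$ in place of $N$. A partial valuation $v$ is a partial level-valuation (for $L$) if $v\in\Pi$ for some $L$-model $\langle\Pi,R\rangle$. -}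

module Defs where

open import Data.Nat using (ℕ; zero; suc)
open import Data.List using (List; []; _∷_)
open import Data.List.Membership.Propositional using (_∈_)
open import Data.Product using (Σ; _×_; _,_)
open import Data.Sum using (_⊎_)
open import Relation.Nullary using (¬_)
open import Level using () renaming (suc to lsuc; zero to lzero)

infixr 5 _⇒_
data Form : Set where
  var : ℕ → Form
  ⊥f  : Form
  _⇒_ : Form → Form → Form
  □_  : Form → Form

-- The fifteen logics of the modal cube (KB5 = KB45, S4 = KT4, S5 = KTB45)

data Logic : Set where
  K KB K4 K5 K45 KD KDB KD4 KD5 KD45 KT KTB S4 S5 KB5 : Logic

data HasT : Logic → Set where
  KT-T : HasT KT
  KTB-T : HasT KTB
  S4-T : HasT S4
  S5-T : HasT S5

data HasD : Logic → Set where
  KD-D : HasD KD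
  KDB-D : HasD KDB
  KD4-D : HasD KD4
  KD5-D : HasD KD5
  KD45-D : HasD KD45
  KT-D : HasD KT
  KTB-D : HasD KTB
  S4-D : HasD S4
  S5-D : HasD S5

data HasB : Logic → Set where
  KB-B : HasB KB
  KDB-B : HasB KDB
  KTB-B : HasB KTB
  S5-B : HasB S5
  KB5-B : HasB KB5

data Has4 : Logic → Set where
  K4-4 : Has4 K4
  K45-4 : Has4 K45
  KD4-4 : Has4 KD4
  KD45-4 : Has4 KD45
  S4-4 : Has4 S4
  S5-4 : Has4 S5
  KB5-4 : Has4 KB5

data Has5 : Logic → Set where
  K5-5 : Has5 K5
  K45-5 : Has5 K45
  KD5-5 : Has5 KD5
  KD45-5 : Has5 KD45
  S5-5 : Has5 S5
  KB5-5 : Has5 KB5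

data TV : Set where
  vF vf vf₂ vf₃ vt₃ vt₂ vt vT : TV

𝒟 N I P PN : List TV
𝒟  = vT ∷ vt ∷ vt₂ ∷ vt₃ ∷ []
N  = vT ∷ vt₂ ∷ vf₃ ∷ vf₂ ∷ []
I  = vF ∷ vf₂ ∷ vt₃ ∷ vt₂ ∷ []
P  = vT ∷ vt ∷ vf₃ ∷ vf ∷ []
PN = vF ∷ vf ∷ vt₃ ∷ vt ∷ []

V : Logic → List TV
V K    = vF ∷ vf ∷ vf₂ ∷ vf₃ ∷ vt₃ ∷ vt₂ ∷ vt ∷ vT ∷ []
V KB   = vF ∷ vf ∷ vf₂ ∷ vf₃ ∷ vt₃ ∷ vt₂ ∷ vt ∷ vT ∷ []
V K4   = vF ∷ vf ∷ vf₂ ∷ vf₃ ∷ vt₃ ∷ vt₂ ∷ vt ∷ vT ∷ []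
V K5   = vF ∷ vf ∷ vf₂ ∷ vf₃ ∷ vt₃ ∷ vt₂ ∷ vt ∷ vT ∷ []
V K45  = vF ∷ vf ∷ vf₂ ∷ vf₃ ∷ vt₃ ∷ vt₂ ∷ vt ∷ vT ∷ []
V KB5  = vF ∷ vf ∷ vf₂ ∷ vt₂ ∷ vt ∷ vT ∷ []
V KD   = vF ∷ vf ∷ vf₃ ∷ vt₃ ∷ vt ∷ vT ∷ []
V KDB  = vF ∷ vf ∷ vf₃ ∷ vt₃ ∷ vt ∷ vT ∷ []
V KD4  = vF ∷ vf ∷ vf₃ ∷ vt₃ ∷ vt ∷ vT ∷ []
V KD5  = vF ∷ vf ∷ vf₃ ∷ vt₃ ∷ vt ∷ vT ∷ []
V KD45 = vF ∷ vf ∷ vf₃ ∷ vt₃ ∷ vt ∷ vT ∷ []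
V KT   = vF ∷ vf ∷ vt ∷ vT ∷ []
V KTB  = vF ∷ vf ∷ vt ∷ vT ∷ []
V S4   = vF ∷ vf ∷ vt ∷ vT ∷ []
V S5   = vF ∷ vf ∷ vt ∷ vT ∷ []

bot~ : List TV
bot~ = vF ∷ vf₂ ∷ []

-- Interpretation of →  (the same table for every L; only arguments in V(L) matter)
imp~ : TV → TV → List TV
imp~ vF _ = vT ∷ []
imp~ vf vF  = vt ∷ []
imp~ vf vf  = vT ∷ vt ∷ []
imp~ vf vf₂ = vt₂ ∷ []
imp~ vf vf₃ = vT ∷ []
imp~ vf vt₃ = vt ∷ []
imp~ vf vt₂ = vT ∷ []
imp~ vf vt  = vT ∷ vt ∷ []
imp~ vf vT  = vT ∷ []
imp~ vf₂ vF  = vt₃ ∷ []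
imp~ vf₂ vf  = vt ∷ []
imp~ vf₂ vf₂ = vt₂ ∷ []
imp~ vf₂ vf₃ = vT ∷ []
imp~ vf₂ vt₃ = vt₃ ∷ []
imp~ vf₂ vt₂ = vt₂ ∷ []
imp~ vf₂ vt  = vt ∷ []
imp~ vf₂ vT  = vT ∷ []
imp~ vf₃ vF  = vt₃ ∷ []
imp~ vf₃ vf  = vt ∷ []
imp~ vf₃ vf₂ = vt₂ ∷ []
imp~ vf₃ vf₃ = vT ∷ []
imp~ vf₃ vt₃ = vt₃ ∷ []
imp~ vf₃ vt₂ = vt₂ ∷ []
imp~ vf₃ vt  = vt ∷ []
imp~ vf₃ vT  = vT ∷ []
imp~ vt₃ vF  = vf₃ ∷ []
imp~ vt₃ vf  = vf₃ ∷ []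
imp~ vt₃ vf₂ = vf₃ ∷ []
imp~ vt₃ vf₃ = vf₃ ∷ []
imp~ vt₃ vt₃ = vT ∷ []
imp~ vt₃ vt₂ = vT ∷ []
imp~ vt₃ vt  = vT ∷ []
imp~ vt₃ vT  = vT ∷ []
imp~ vt₂ vF  = vF ∷ []
imp~ vt₂ vf  = vf ∷ []
imp~ vt₂ vf₂ = vf₂ ∷ []
imp~ vt₂ vf₃ = vf₃ ∷ []
imp~ vt₂ vt₃ = vt₃ ∷ []
imp~ vt₂ vt₂ = vt₂ ∷ []
imp~ vt₂ vt  = vt₃ ∷ []
imp~ vt₂ vT  = vT ∷ []
imp~ vt vF  = vf ∷ []
imp~ vt vf  = vf ∷ vf₃ ∷ []
imp~ vt vf₂ = vf₃ ∷ []
imp~ vt vf₃ = vf₃ ∷ []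
imp~ vt vt₃ = vt ∷ []
imp~ vt vt₂ = vT ∷ []
imp~ vt vt  = vT ∷ vt ∷ []
imp~ vt vT  = vT ∷ []
imp~ vT y = y ∷ []

-- Interpretation of □ (arguments outside V(L) are mapped to [] ; they never occur)
box~ : Logic → TV → List TV
box~ K vF  = vF ∷ vf ∷ vf₃ ∷ []
box~ K vf  = vF ∷ vf ∷ vf₃ ∷ []
box~ K vt₃ = vF ∷ vf ∷ vf₃ ∷ []
box~ K vt  = vF ∷ vf ∷ vf₃ ∷ []
box~ K vf₂ = vt₂ ∷ []
box~ K vt₂ = vt₂ ∷ []
box~ K vf₃ = vT ∷ vt ∷ vt₃ ∷ []
box~ K vT  = vT ∷ vt ∷ vt₃ ∷ []
box~ KB vF  = vF ∷ []
box~ KB vf  = vF ∷ []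
box~ KB vf₂ = vt₂ ∷ []
box~ KB vt₂ = vt₂ ∷ []
box~ KB vf₃ = vt₃ ∷ []
box~ KB vt₃ = vF ∷ vf ∷ vf₃ ∷ []
box~ KB vt  = vF ∷ vf ∷ vf₃ ∷ []
box~ KB vT  = vT ∷ vt ∷ vt₃ ∷ []
box~ K4 vF  = vF ∷ vf ∷ vf₃ ∷ []
box~ K4 vf  = vF ∷ vf ∷ vf₃ ∷ []
box~ K4 vt₃ = vF ∷ vf ∷ vf₃ ∷ []
box~ K4 vt  = vF ∷ vf ∷ vf₃ ∷ []
box~ K4 vf₂ = vt₂ ∷ []
box~ K4 vt₂ = vt₂ ∷ []
box~ K4 vf₃ = vT ∷ []
box~ K4 vT  = vT ∷ []
box~ K5 vF  = vF ∷ []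
box~ K5 vf  = vF ∷ []
box~ K5 vt₃ = vF ∷ []
box~ K5 vt  = vF ∷ []
box~ K5 vf₂ = vt₂ ∷ []
box~ K5 vt₂ = vt₂ ∷ []
box~ K5 vf₃ = vT ∷ vt₃ ∷ []
box~ K5 vT  = vT ∷ vt₃ ∷ []
box~ K45 vF  = vF ∷ []
box~ K45 vf  = vF ∷ []
box~ K45 vt₃ = vF ∷ []
box~ K45 vt  = vF ∷ []
box~ K45 vf₂ = vt₂ ∷ []
box~ K45 vt₂ = vt₂ ∷ []
box~ K45 vf₃ = vT ∷ []
box~ K45 vT  = vT ∷ []
box~ KB5 vF  = vF ∷ []
box~ KB5 vf  = vF ∷ []
box~ KB5 vt  = vF ∷ []
box~ KB5 vf₂ = vt₂ ∷ []
box~ KB5 vt₂ = vt₂ ∷ []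
box~ KB5 vT  = vT ∷ []
box~ KB5 vf₃ = []
box~ KB5 vt₃ = []
box~ KD vF  = vF ∷ vf ∷ vf₃ ∷ []
box~ KD vf  = vF ∷ vf ∷ vf₃ ∷ []
box~ KD vt₃ = vF ∷ vf ∷ vf₃ ∷ []
box~ KD vt  = vF ∷ vf ∷ vf₃ ∷ []
box~ KD vf₃ = vT ∷ vt ∷ vt₃ ∷ []
box~ KD vT  = vT ∷ vt ∷ vt₃ ∷ []
box~ KD vf₂ = []
box~ KD vt₂ = []
box~ KDB vF  = vF ∷ []
box~ KDB vf  = vF ∷ []
box~ KDB vf₃ = vt₃ ∷ []
box~ KDB vt₃ = vF ∷ vf ∷ vf₃ ∷ []
box~ KDB vt  = vF ∷ vf ∷ vf₃ ∷ []
box~ KDB vT  = vT ∷ vt ∷ vt₃ ∷ []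
box~ KDB vf₂ = []
box~ KDB vt₂ = []
box~ KD4 vF  = vF ∷ []
box~ KD4 vt₃ = vF ∷ []
box~ KD4 vf  = vF ∷ vf ∷ vf₃ ∷ []
box~ KD4 vt  = vF ∷ vf ∷ vf₃ ∷ []
box~ KD4 vf₃ = vT ∷ []
box~ KD4 vT  = vT ∷ []
box~ KD4 vf₂ = []
box~ KD4 vt₂ = []
box~ KD5 vF  = vF ∷ []
box~ KD5 vf  = vF ∷ []
box~ KD5 vt₃ = vF ∷ []
box~ KD5 vt  = vF ∷ []
box~ KD5 vf₃ = vT ∷ vt₃ ∷ []
box~ KD5 vT  = vT ∷ vt₃ ∷ []
box~ KD5 vf₂ = []
box~ KD5 vt₂ = []
box~ KD45 vF  = vF ∷ []
box~ KD45 vf  = vF ∷ []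
box~ KD45 vt₃ = vF ∷ []
box~ KD45 vt  = vF ∷ []
box~ KD45 vf₃ = vT ∷ []
box~ KD45 vT  = vT ∷ []
box~ KD45 vf₂ = []
box~ KD45 vt₂ = []
box~ KT vF = vF ∷ []
box~ KT vf = vF ∷ vf ∷ []
box~ KT vt = vF ∷ vf ∷ []
box~ KT vT = vT ∷ vt ∷ []
box~ KT _  = []
box~ KTB vF = vF ∷ []
box~ KTB vf = vF ∷ []
box~ KTB vt = vF ∷ vf ∷ []
box~ KTB vT = vT ∷ vt ∷ []
box~ KTB _  = []
box~ S4 vF = vF ∷ []
box~ S4 vf = vF ∷ vf ∷ []
box~ S4 vt = vF ∷ vf ∷ []
box~ S4 vT = vT ∷ []
box~ S4 _  = []
box~ S5 vF = vF ∷ []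
box~ S5 vf = vF ∷ []
box~ S5 vt = vF ∷ []
box~ S5 vT = vT ∷ []
box~ S5 _  = []

record IsValuation (L : Logic) (v : Form → TV) : Set where
  field
    inV  : ∀ β → v β ∈ V L
    bot  : v ⊥f ∈ bot~
    imp  : ∀ β γ → v (β ⇒ γ) ∈ imp~ (v β) (v γ)
    box  : ∀ β → v (□ β) ∈ box~ L (v β)

Lvl : Logic → ℕ → (Form → TV) → Set
Lvl L zero v =
  IsValuation L v ×
  (∀ β → (v β ∈ vf₂ ∷ vt₂ ∷ []) → ∀ γ → v γ ∈ vf₂ ∷ vt₂ ∷ [])
Lvl L (suc n) v =
  Lvl L n v ×
  (∀ β → (∀ w → Lvl L n w → w β ∈ 𝒟) → v β ∈ vT ∷ vt₂ ∷ [])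

LevelValuation : Logic → (Form → TV) → Set
LevelValuation L v = ∀ n → Lvl L n v

record SubformulaClosed (Λ : Form → Set) : Set where
  field
    imp-l : ∀ β γ → Λ (β ⇒ γ) → Λ β
    imp-r : ∀ β γ → Λ (β ⇒ γ) → Λ γ
    box-a : ∀ β → Λ (□ β) → Λ β

PMap : (Form → Set) → Set
PMap Λ = (β : Form) → Λ β → TV

record IsPartialValuation (L : Logic) (Λ : Form → Set) (v : PMap Λ) : Set where
  field
    inV : ∀ β (p : Λ β) → v β p ∈ V L
    bot : (p : Λ ⊥f) → v ⊥f p ∈ bot~
    imp : ∀ β γ (p : Λ (β ⇒ γ)) (pβ : Λ β) (pγ : Λ γ) →
          v (β ⇒ γ) p ∈ imp~ (v β pβ) (v γ pγ)
    box : ∀ β (p : Λ (□ β)) (pβ : Λ β) → v (□ β) p ∈ box~ L (v β pβ)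

restrict : (Λ : Form → Set) → (Form → TV) → PMap Λ
restrict Λ v β _ = v β

record IsLModel (L : Logic) (Λ : Form → Set)
                (Π : PMap Λ → Set) (R : PMap Λ → PMap Λ → Set) : Set₁ where
  field
    Π-partial : ∀ v → Π v → IsPartialValuation L Λ v
    R-dom : ∀ v w → R v w → Π v
    R-cod : ∀ v w → R v w → Π w
    pre-P  : ∀ v → Π v → ∀ β (p : Λ β) → v β p ∈ P →
             Σ (PMap Λ) λ w → Π w × R v w × w β p ∈ 𝒟
    pre-PN : ∀ v → Π v → ∀ β (p : Λ β) → v β p ∈ PN →
             Σ (PMap Λ) λ w → Π w × R v w × ¬ (w β p ∈ 𝒟)
    K-N : ∀ v w → R v w → ∀ β (p : Λ β) → v β p ∈ N → w β p ∈ 𝒟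
    K-I : ∀ v w → R v w → ∀ β (p : Λ β) → v β p ∈ I → ¬ (w β p ∈ 𝒟)
    T-N : HasT L → ∀ v → Π v → ∀ β (p : Λ β) → v β p ∈ N → v β p ∈ 𝒟
    T-I : HasT L → ∀ v → Π v → ∀ β (p : Λ β) → v β p ∈ I → ¬ (v β p ∈ 𝒟)
    D-N : HasD L → ∀ v → Π v → ∀ β (p : Λ β) → v β p ∈ N → v β p ∈ P
    D-I : HasD L → ∀ v → Π v → ∀ β (p : Λ β) → v β p ∈ I → v β p ∈ PN
    B-D  : HasB L → ∀ v w → R v w → ∀ β (p : Λ β) → v β p ∈ 𝒟 → w β p ∈ P
    B-nD : HasB L → ∀ v w → R v w → ∀ β (p : Λ β) → ¬ (v β p ∈ 𝒟) → w β p ∈ PN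
    4-N : Has4 L → ∀ v w → R v w → ∀ β (p : Λ β) → v β p ∈ N → w β p ∈ N
    4-I : Has4 L → ∀ v w → R v w → ∀ β (p : Λ β) → v β p ∈ I → w β p ∈ I
    5-P  : Has5 L → ∀ v w → R v w → ∀ β (p : Λ β) → v β p ∈ P → w β p ∈ P
    5-PN : Has5 L → ∀ v w → R v w → ∀ β (p : Λ β) → v β p ∈ PN → w β p ∈ PN
    5-N  : Has5 L → ∀ v w w' → Π w' → R v w → (R v w' ⊎ R w w') →
           ∀ β (p : Λ β) → v β p ∈ N → w β p ∈ N → w' β p ∈ N
    5-I  : Has5 L → ∀ v w w' → Π w' → R v w → (R v w' ⊎ R w w') →
           ∀ β (p : Λ β) → v β p ∈ I → w β p ∈ I → w' β p ∈ I

PartialLevelValuation : (L : Logic) (Λ : Form → Set) → PMap Λ → Set₁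
PartialLevelValuation L Λ v =
  Σ (PMap Λ → Set) λ Π → Σ (PMap Λ → PMap Λ → Set) λ R →
    IsLModel L Λ Π R × Π v

{-# OPTIONS --safe #-}
module Submission where

-- Partial level-valuations arise as restrictions of the worlds of a canonical
-- model. Under a level-0 valuation the value of a formula X is determined by
-- three bits: whether X, □X and □¬X are designated (membership of X in 𝒟, N
-- and I). A level valuation g with g(⊥) = F thus behaves like a maximal
-- consistent set, and validity over L₀ turns into necessity at the next level.
-- A Lindenbaum construction along an enumeration of all formulas therefore
-- extends any formula C with g(C) ∈ P to a level valuation h with N(g) ⊆ 𝒟(h),
-- I(g) ∩ 𝒟(h) = ∅ and h(C) ∈ 𝒟. The level valuations reachable from v along
-- this relation, restricted to Λ, form an L-model. Its frame conditions follow
-- from finitely many facts about the tables of M_L; for (5) one also needs that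
-- the successors of all reachable worlds agree on N with the □-values of v.

open import Data.Bool using (Bool; true; false; not; _∧_; _∨_; _xor_)
open import Data.Bool.ListAction using (all)
open import Data.Bool.Properties using (not-involutive; not-injective; ∧-conicalˡ; ∧-conicalʳ)
open import Data.Empty using (⊥; ⊥-elim)
open import Data.Fin using (Fin; #_)
import Data.Fin.Properties as Fin
open import Data.List using (List; []; _∷_; _++_; lookup; concatMap; cartesianProductWith)
  renaming (map to mapˡ)
open import Data.List.Membership.Propositional using (_∈_; lose)
open import Data.List.Membership.Propositional.Properties
  using (∈-lookup; ∈-concatMap⁺; ∈-++⁺ˡ; ∈-++⁺ʳ; ∈-map⁺; ∈-cartesianProductWith⁺)
open import Data.List.Relation.Unary.Any using (here; there)
open import Data.Nat using (ℕ; zero; suc; _*_; _⊔_; _≤_; _<_; _≤′_; ≤′-reflexive; ≤′-step; z≤n)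
open import Data.Nat.Properties using (m≤m⊔n; m≤n⊔m; m⊔n<o⇒m<o; m⊔n<o⇒n<o; ≤⇒≤′; ≤-refl)
open import Data.Product using (Σ; _×_; _,_; proj₁; proj₂)
open import Data.Sum using (_⊎_; inj₁; inj₂; [_,_]′)
import Data.Sum as Sum
open import Data.Vec using (Vec; []; _∷_; map; concat)
open import Data.Vec.Properties using (map-cong)
open import Function using (_∘_)
open import Relation.Binary.Definitions using (DecidableEquality)
open import Relation.Binary.PropositionalEquality hiding ([_])
open import Relation.Nullary using (¬_; does; yes; no; map′)
open import Relation.Nullary.Decidable using (dec-true; dec-false)

open import Defs

open ≡-Reasoning

infixr 5 _⇒ᵇ_
_⇒ᵇ_ : Bool → Bool → Bool
a ⇒ᵇ b = not a ∨ b

⇒ᵇ-mp : ∀ {a b} → (a ⇒ᵇ b) ≡ true → a ≡ true → b ≡ true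
⇒ᵇ-mp a⇒b refl = a⇒b

⇒ᵇ-intro : ∀ {a b} → (a ≡ true → b ≡ true) → (a ⇒ᵇ b) ≡ true
⇒ᵇ-intro {true}  a→b = a→b refl
⇒ᵇ-intro {false} _   = refl

infix 4 _⇔ᵇ_
_⇔ᵇ_ : Bool → Bool → Bool
a ⇔ᵇ b = not (a xor b)

⇔ᵇ-sound : ∀ {a b} → (a ⇔ᵇ b) ≡ true → a ≡ b
⇔ᵇ-sound {true}  {true}  _ = refl
⇔ᵇ-sound {false} {false} _ = refl

⇔⇒≡ : ∀ {a b} → (a ≡ true → b ≡ true) → (b ≡ true → a ≡ true) → a ≡ b
⇔⇒≡ {true}          a→b _   = sym (a→b refl)
⇔⇒≡ {false} {false} _   _   = refl
⇔⇒≡ {false} {true}  _   b→a = b→a refl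

all-∈ : ∀ {A : Set} (f : A → Bool) {xs x} → all f xs ≡ true → x ∈ xs → f x ≡ true
all-∈ f {y ∷ _} holds (here refl) = ∧-conicalˡ (f y) _ holds
all-∈ f {y ∷ _} holds (there x∈)  = all-∈ f (∧-conicalʳ (f y) _ holds) x∈

-- Truth values as bit triples

tvs : List TV
tvs = vF ∷ vf ∷ vf₂ ∷ vf₃ ∷ vt₃ ∷ vt₂ ∷ vt ∷ vT ∷ []

index : TV → Fin 8
index vF  = # 0
index vf  = # 1
index vf₂ = # 2
index vf₃ = # 3
index vt₃ = # 4
index vt₂ = # 5
index vt  = # 6
index vT  = # 7

lookup-index : ∀ x → lookup tvs (index x) ≡ x
lookup-index vF  = refl
lookup-index vf  = refl
lookup-index vf₂ = refl
lookup-index vf₃ = refl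
lookup-index vt₃ = refl
lookup-index vt₂ = refl
lookup-index vt  = refl
lookup-index vT  = refl

index-injective : ∀ {x y} → index x ≡ index y → x ≡ y
index-injective {x} {y} eq = begin
  x                     ≡⟨ sym (lookup-index x) ⟩
  lookup tvs (index x)  ≡⟨ cong (lookup tvs) eq ⟩
  lookup tvs (index y)  ≡⟨ lookup-index y ⟩
  y                     ∎

_≟ᵛ_ : DecidableEquality TV
x ≟ᵛ y = map′ index-injective (cong index) (index x Fin.≟ index y)

∈-tvs : ∀ x → x ∈ tvs
∈-tvs x = subst (_∈ tvs) (lookup-index x) (∈-lookup (index x))

every : ∀ (f : TV → Bool) → all f tvs ≡ true → ∀ x → f x ≡ true
every f holds x = all-∈ f holds (∈-tvs x)

every-≡ : ∀ (f g : TV → Bool) → all (λ x → f x ⇔ᵇ g x) tvs ≡ true → ∀ x → f x ≡ g x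
every-≡ f g holds x = ⇔ᵇ-sound (every (λ x → f x ⇔ᵇ g x) holds x)

open import Data.List.Membership.DecPropositional _≟ᵛ_ using (_∈?_)

infix 8 _∈ᵇ_
_∈ᵇ_ : TV → List TV → Bool
x ∈ᵇ xs = does (x ∈? xs)

∈ᵇ⇒∈ : ∀ {x xs} → x ∈ᵇ xs ≡ true → x ∈ xs
∈ᵇ⇒∈ {x} {xs} eq with x ∈? xs
∈ᵇ⇒∈ _  | yes x∈xs = x∈xs
∈ᵇ⇒∈ () | no _

∈⇒∈ᵇ : ∀ {x xs} → x ∈ xs → x ∈ᵇ xs ≡ true
∈⇒∈ᵇ {x} {xs} = dec-true (x ∈? xs)

∈ᵇ≡false⇒∉ : ∀ {x xs} → x ∈ᵇ xs ≡ false → ¬ (x ∈ xs)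
∈ᵇ≡false⇒∉ x∉ x∈ with () ← trans (sym x∉) (∈⇒∈ᵇ x∈)

∉⇒∈ᵇ≡false : ∀ {x xs} → ¬ (x ∈ xs) → x ∈ᵇ xs ≡ false
∉⇒∈ᵇ≡false {x} {xs} = dec-false (x ∈? xs)

isD isN isI isP isPN trivial : TV → Bool
isD x     = x ∈ᵇ 𝒟
isN x     = x ∈ᵇ N
isI x     = x ∈ᵇ I
isP x     = x ∈ᵇ P
isPN x    = x ∈ᵇ PN
trivial x = x ∈ᵇ (vf₂ ∷ vt₂ ∷ [])

fromBits : Bool → Bool → Bool → TV
fromBits true  true  false = vT
fromBits true  false false = vt
fromBits true  true  true  = vt₂
fromBits true  false true  = vt₃
fromBits false true  false = vf₃
fromBits false false false = vf
fromBits false true  true  = vf₂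
fromBits false false true  = vF

fromBits-bits : ∀ x → fromBits (isD x) (isN x) (isI x) ≡ x
fromBits-bits vF  = refl
fromBits-bits vf  = refl
fromBits-bits vf₂ = refl
fromBits-bits vf₃ = refl
fromBits-bits vt₃ = refl
fromBits-bits vt₂ = refl
fromBits-bits vt  = refl
fromBits-bits vT  = refl

isD-fromBits : ∀ a b c → isD (fromBits a b c) ≡ a
isD-fromBits true  true  false = refl
isD-fromBits true  false false = refl
isD-fromBits true  true  true  = refl
isD-fromBits true  false true  = refl
isD-fromBits false true  false = refl
isD-fromBits false false false = refl
isD-fromBits false true  true  = refl
isD-fromBits false false true  = refl

fromBits-necessary : ∀ c → fromBits true true c ∈ vT ∷ vt₂ ∷ []
fromBits-necessary true  = there (here refl)
fromBits-necessary false = here refl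

isN-necessary-value : ∀ {x} → x ∈ vT ∷ vt₂ ∷ [] → isN x ≡ true
isN-necessary-value (here refl)         = refl
isN-necessary-value (there (here refl)) = refl

isP≡not-isI : ∀ x → isP x ≡ not (isI x)
isP≡not-isI = every-≡ isP (λ x → not (isI x)) refl

isI≡not-isP : ∀ x → isI x ≡ not (isP x)
isI≡not-isP = every-≡ isI (λ x → not (isP x)) refl

isPN≡not-isN : ∀ x → isPN x ≡ not (isN x)
isPN≡not-isN = every-≡ isPN (λ x → not (isN x)) refl

isP⇒nontrivial : ∀ x → isP x ≡ true → trivial x ≡ false
isP⇒nontrivial x Px = not-injective (⇒ᵇ-mp (every (λ x → isP x ⇒ᵇ not (trivial x)) refl x) Px)

isPN⇒nontrivial : ∀ x → isPN x ≡ true → trivial x ≡ false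
isPN⇒nontrivial x PNx = not-injective (⇒ᵇ-mp (every (λ x → isPN x ⇒ᵇ not (trivial x)) refl x) PNx)

every-imp : ∀ (f : TV → TV → TV → Bool) →
            all (λ x → all (λ y → all (f x y) (imp~ x y)) tvs) tvs ≡ true →
            ∀ x y {z} → z ∈ imp~ x y → f x y z ≡ true
every-imp f holds x y = all-∈ (f x y) (every (fˣ x) (every (λ x → all (fˣ x) tvs) holds x) y)
  where
    fˣ : TV → TV → Bool
    fˣ x y = all (f x y) (imp~ x y)

isD-imp : ∀ x y {z} → z ∈ imp~ x y → isD z ≡ (isD x ⇒ᵇ isD y)
isD-imp x y z∈ = ⇔ᵇ-sound (every-imp (λ x y z → isD z ⇔ᵇ (isD x ⇒ᵇ isD y)) refl x y z∈)

isN-imp : ∀ x y {z} → z ∈ imp~ x y → isN z ≡ true → isN x ≡ true → isN y ≡ true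
isN-imp x y z∈ Nz Nx =
  ⇒ᵇ-mp (⇒ᵇ-mp (every-imp (λ x y z → isN z ⇒ᵇ isN x ⇒ᵇ isN y) refl x y z∈) Nz) Nx

isN-¬-nontrivial : ∀ x {z} → trivial x ≡ false → z ∈ imp~ x vF → isN z ≡ isI x
isN-¬-nontrivial x nontrivial z∈ = ⇔ᵇ-sound (all-∈ _ (⇒ᵇ-mp table (cong not nontrivial)) z∈)
  where
    table : (not (trivial x) ⇒ᵇ all (λ z → isN z ⇔ᵇ isI x) (imp~ x vF)) ≡ true
    table = every (λ x → not (trivial x) ⇒ᵇ all (λ z → isN z ⇔ᵇ isI x) (imp~ x vF)) refl x

isN-¬-trivial : ∀ x {z} → trivial x ≡ true → z ∈ imp~ x vf₂ → isN z ≡ isI x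
isN-¬-trivial x triv z∈ = ⇔ᵇ-sound (all-∈ _ (⇒ᵇ-mp table triv) z∈)
  where
    table : (trivial x ⇒ᵇ all (λ z → isN z ⇔ᵇ isI x) (imp~ x vf₂)) ≡ true
    table = every (λ x → trivial x ⇒ᵇ all (λ z → isN z ⇔ᵇ isI x) (imp~ x vf₂)) refl x

every-value : ∀ {L} (f : TV → Bool) → all (λ x → x ∈ᵇ V L ⇒ᵇ f x) tvs ≡ true →
              ∀ {x} → x ∈ V L → f x ≡ true
every-value {L} f holds {x} x∈ = ⇒ᵇ-mp (every (λ x → x ∈ᵇ V L ⇒ᵇ f x) holds x) (∈⇒∈ᵇ x∈)

record OnValues (L : Logic) (f : TV → Bool) : Set where
  constructor checked
  field holds : all (λ x → x ∈ᵇ V L ⇒ᵇ f x) tvs ≡ true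

on-values : ∀ {L f} → OnValues L f → ∀ {x} → x ∈ V L → f x ≡ true
on-values {f = f} (checked holds) = every-value f holds

box-table : ∀ L → OnValues L (λ x → all (λ z → isD z ⇔ᵇ isN x) (box~ L x))
box-table K    = checked refl
box-table KB   = checked refl
box-table K4   = checked refl
box-table K5   = checked refl
box-table K45  = checked refl
box-table KD   = checked refl
box-table KDB  = checked refl
box-table KD4  = checked refl
box-table KD5  = checked refl
box-table KD45 = checked refl
box-table KT   = checked refl
box-table KTB  = checked refl
box-table S4   = checked refl
box-table S5   = checked refl
box-table KB5  = checked refl

isD-box : ∀ L {x z} → x ∈ V L → z ∈ box~ L x → isD z ≡ isN x
isD-box L x∈ z∈ = ⇔ᵇ-sound (all-∈ _ (on-values (box-table L) x∈) z∈)

infix 9 _[_]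
data Ctx : Set where
  ∙   : Ctx
  □ᶜ_ : Ctx → Ctx
  ¬ᶜ_ : Ctx → Ctx

_[_] : Ctx → Form → Form
∙      [ X ] = X
(□ᶜ c) [ X ] = □ (c [ X ])
(¬ᶜ c) [ X ] = (c [ X ]) ⇒ ⊥f

-- The possible values of c [ X ] when X has value x and ⊥ has value F.
values : Logic → TV → Ctx → List TV
values L x ∙      = x ∷ []
values L x (□ᶜ c) = concatMap (box~ L) (values L x c)
values L x (¬ᶜ c) = concatMap (λ a → imp~ a vF) (values L x c)

◇ᶜ ¬□ᶜ □¬ᶜ : Ctx
◇ᶜ  = ¬ᶜ □ᶜ ¬ᶜ ∙
¬□ᶜ = ¬ᶜ □ᶜ ∙
□¬ᶜ = □ᶜ ¬ᶜ ∙

necessaryIn : Logic → TV → Ctx → Bool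
necessaryIn L x c = all isN (values L x c)

record Forces (L : Logic) (p : TV → Bool) (c : Ctx) : Set where
  constructor checked
  field holds : all (λ x → x ∈ᵇ V L ⇒ᵇ not (trivial x) ⇒ᵇ p x ⇒ᵇ necessaryIn L x c) tvs ≡ true

forces-necessary : ∀ {L p c} → Forces L p c → ∀ {x} → x ∈ V L → trivial x ≡ false → p x ≡ true →
                   necessaryIn L x c ≡ true
forces-necessary {L} {p} {c} (checked holds) x∈ nontrivial px =
  ⇒ᵇ-mp (⇒ᵇ-mp (every-value (λ x → not (trivial x) ⇒ᵇ p x ⇒ᵇ necessaryIn L x c) holds x∈)
               (cong not nontrivial)) px

record BoxValues (L : Logic) (f : TV → Bool) : Set where
  constructor checked
  field holds : all (λ x → x ∈ᵇ V L ⇒ᵇ not (trivial x) ⇒ᵇ all f (values L x (□ᶜ ∙))) tvs ≡ true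

box-values : ∀ {L f} → BoxValues L f → ∀ {x z} → x ∈ V L → trivial x ≡ false → z ∈ values L x (□ᶜ ∙) →
             f z ≡ true
box-values {L} {f} (checked holds) x∈ nontrivial z∈ =
  all-∈ f (⇒ᵇ-mp (every-value (λ x → not (trivial x) ⇒ᵇ all f (values L x (□ᶜ ∙))) holds x∈)
                 (cong not nontrivial)) z∈

T-table : ∀ {L} → HasT L → OnValues L (λ x → isN x ⇒ᵇ isD x) × OnValues L (λ x → isI x ⇒ᵇ not (isD x))
T-table KT-T  = checked refl , checked refl
T-table KTB-T = checked refl , checked refl
T-table S4-T  = checked refl , checked refl
T-table S5-T  = checked refl , checked refl

D-table : ∀ {L} → HasD L → OnValues L (λ x → isN x ⇒ᵇ isP x) × OnValues L (λ x → isI x ⇒ᵇ isPN x)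
D-table KD-D   = checked refl , checked refl
D-table KDB-D  = checked refl , checked refl
D-table KD4-D  = checked refl , checked refl
D-table KD5-D  = checked refl , checked refl
D-table KD45-D = checked refl , checked refl
D-table KT-D   = checked refl , checked refl
D-table KTB-D  = checked refl , checked refl
D-table S4-D   = checked refl , checked refl
D-table S5-D   = checked refl , checked refl

B-table : ∀ {L} → HasB L → Forces L isD ◇ᶜ × Forces L (λ x → not (isD x)) ¬□ᶜ
B-table KB-B  = checked refl , checked refl
B-table KDB-B = checked refl , checked refl
B-table KTB-B = checked refl , checked refl
B-table S5-B  = checked refl , checked refl
B-table KB5-B = checked refl , checked refl

4-table : ∀ {L} → Has4 L → Forces L isN (□ᶜ ∙) × Forces L isI □¬ᶜ
4-table K4-4   = checked refl , checked refl
4-table K45-4  = checked refl , checked refl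
4-table KD4-4  = checked refl , checked refl
4-table KD45-4 = checked refl , checked refl
4-table S4-4   = checked refl , checked refl
4-table S5-4   = checked refl , checked refl
4-table KB5-4  = checked refl , checked refl

record 5-Tables (L : Logic) : Set where
  constructor 5-tables
  field
    possible⇒□◇            : Forces L isP ◇ᶜ
    possibly-not⇒□¬□       : Forces L isPN ¬□ᶜ
    □-possible⇒necessary   : BoxValues L (λ z → isP z ⇒ᵇ isN z)
    □-necessary⇒designated : BoxValues L (λ z → isN z ⇒ᵇ isD z)

5-table : ∀ {L} → Has5 L → 5-Tables L
5-table K5-5   = 5-tables (checked refl) (checked refl) (checked refl) (checked refl)
5-table K45-5  = 5-tables (checked refl) (checked refl) (checked refl) (checked refl)
5-table KD5-5  = 5-tables (checked refl) (checked refl) (checked refl) (checked refl)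
5-table KD45-5 = 5-tables (checked refl) (checked refl) (checked refl) (checked refl)
5-table S5-5   = 5-tables (checked refl) (checked refl) (checked refl) (checked refl)
5-table KB5-5  = 5-tables (checked refl) (checked refl) (checked refl) (checked refl)

infixr 20 ¬ᶠ_ ◇_
¬ᶠ_ : Form → Form
¬ᶠ X = X ⇒ ⊥f

◇_ : Form → Form
◇ X = ¬ᶠ □ ¬ᶠ X

infixr 6 _∧ᶠ_
_∧ᶠ_ : Form → Form → Form
X ∧ᶠ Y = ¬ᶠ (X ⇒ ¬ᶠ Y)

module _ {L : Logic} {w : Form → TV} (w-val : IsValuation L w) where
  open IsValuation w-val

  isD-⊥ : isD (w ⊥f) ≡ false
  isD-⊥ with w ⊥f | bot
  ... | .vF  | here refl         = refl
  ... | .vf₂ | there (here refl) = refl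

  isD-⇒ : ∀ X Y → isD (w (X ⇒ Y)) ≡ (isD (w X) ⇒ᵇ isD (w Y))
  isD-⇒ X Y = isD-imp (w X) (w Y) (imp X Y)

  isD-⇒-intro : ∀ {X Y} → (isD (w X) ≡ true → isD (w Y) ≡ true) → isD (w (X ⇒ Y)) ≡ true
  isD-⇒-intro {X} {Y} X→Y = trans (isD-⇒ X Y) (⇒ᵇ-intro X→Y)

  isD-⇒-mp : ∀ {X Y} → isD (w (X ⇒ Y)) ≡ true → isD (w X) ≡ true → isD (w Y) ≡ true
  isD-⇒-mp {X} {Y} DX⇒Y = ⇒ᵇ-mp (trans (sym (isD-⇒ X Y)) DX⇒Y)

  isD-¬ : ∀ X → isD (w (¬ᶠ X)) ≡ not (isD (w X))
  isD-¬ X rewrite isD-⇒ X ⊥f | isD-⊥ with isD (w X)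
  ... | true  = refl
  ... | false = refl

  isD-excluded-middle : ∀ X → isD (w X) ≡ true ⊎ isD (w (¬ᶠ X)) ≡ true
  isD-excluded-middle X with isD (w X) in DX
  ... | true  = inj₁ refl
  ... | false = inj₂ (trans (isD-¬ X) (cong not DX))

  isD-∧ : ∀ X Y → isD (w (X ∧ᶠ Y)) ≡ isD (w X) ∧ isD (w Y)
  isD-∧ X Y rewrite isD-¬ (X ⇒ ¬ᶠ Y) | isD-⇒ X (¬ᶠ Y) | isD-¬ Y with isD (w X)
  ... | true  = not-involutive _
  ... | false = refl

  isD-□ : ∀ X → isD (w (□ X)) ≡ isN (w X)
  isD-□ X = isD-box L (inV X) (box X)

  isN-mp : ∀ {X Y} → isN (w (X ⇒ Y)) ≡ true → isN (w X) ≡ true → isN (w Y) ≡ true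
  isN-mp {X} {Y} = isN-imp (w X) (w Y) (imp X Y)

  value∈values : w ⊥f ≡ vF → ∀ c X → w (c [ X ]) ∈ values L (w X) c
  value∈values ⊥≡F ∙      X = here refl
  value∈values ⊥≡F (□ᶜ c) X = ∈-concatMap⁺ (box~ L) (lose (value∈values ⊥≡F c X) (box (c [ X ])))
  value∈values ⊥≡F (¬ᶜ c) X = ∈-concatMap⁺ (λ a → imp~ a vF) (lose (value∈values ⊥≡F c X)
    (subst (λ b → w (¬ᶠ (c [ X ])) ∈ imp~ (w (c [ X ])) b) ⊥≡F (imp (c [ X ]) ⊥f)))

fromDesignated : (Form → Bool) → Form → TV
fromDesignated ρ X = fromBits (ρ X) (ρ (□ X)) (ρ (□ ¬ᶠ X))

Lvl-base : ∀ {L w} n → Lvl L n w → Lvl L 0 w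
Lvl-base zero    w₀ = w₀
Lvl-base (suc n) wₙ = Lvl-base n (proj₁ wₙ)

Lvl-suc-necessary : ∀ {L w} n → Lvl L (suc n) w → ∀ X → (∀ u → Lvl L n u → u X ∈ 𝒟) → isN (w X) ≡ true
Lvl-suc-necessary n wₛ X designated = isN-necessary-value (proj₂ wₛ X designated)

module _ {L : Logic} {w : Form → TV} (w₀ : Lvl L 0 w) where
  private
    w-val : IsValuation L w
    w-val = proj₁ w₀
  open IsValuation w-val

  trivial-spreads : ∀ X Y → trivial (w X) ≡ true → trivial (w Y) ≡ true
  trivial-spreads X Y tX = ∈⇒∈ᵇ (proj₂ w₀ X (∈ᵇ⇒∈ tX) Y)

  ⊥-dichotomy : ∀ X → (w ⊥f ≡ vF × trivial (w X) ≡ false) ⊎ (w ⊥f ≡ vf₂ × trivial (w X) ≡ true)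
  ⊥-dichotomy X with w ⊥f in ⊥≡ | bot | trivial (w X) in tX
  ... | .vF  | here refl         | false = inj₁ (refl , refl)
  ... | .vf₂ | there (here refl) | true  = inj₂ (refl , refl)
  ... | .vF  | here refl         | true  with () ← trans (sym (cong trivial ⊥≡)) (trivial-spreads X ⊥f tX)
  ... | .vf₂ | there (here refl) | false with () ← trans (sym tX) (trivial-spreads ⊥f X (cong trivial ⊥≡))

  ⊥≡F⇒nontrivial : w ⊥f ≡ vF → ∀ X → trivial (w X) ≡ false
  ⊥≡F⇒nontrivial ⊥≡F X with ⊥-dichotomy X
  ... | inj₁ (_ , nontrivial) = nontrivial
  ... | inj₂ (⊥≡f₂ , _) with () ← trans (sym ⊥≡F) ⊥≡f₂

  nontrivial⇒⊥≡F : ∀ X → trivial (w X) ≡ false → w ⊥f ≡ vF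
  nontrivial⇒⊥≡F X nontrivial with ⊥-dichotomy X
  ... | inj₁ (⊥≡F , _)  = ⊥≡F
  ... | inj₂ (_ , triv) with () ← trans (sym nontrivial) triv

  isN-¬ : ∀ X → isN (w (¬ᶠ X)) ≡ isI (w X)
  isN-¬ X with ⊥-dichotomy X
  ... | inj₁ (⊥≡F , nontrivial) =
    isN-¬-nontrivial (w X) nontrivial (subst (λ b → w (¬ᶠ X) ∈ imp~ (w X) b) ⊥≡F (imp X ⊥f))
  ... | inj₂ (⊥≡f₂ , triv) =
    isN-¬-trivial (w X) triv (subst (λ b → w (¬ᶠ X) ∈ imp~ (w X) b) ⊥≡f₂ (imp X ⊥f))

  isD-□¬ : ∀ X → isD (w (□ ¬ᶠ X)) ≡ isI (w X)
  isD-□¬ X = trans (isD-□ w-val (¬ᶠ X)) (isN-¬ X)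

  isD-◇ : ∀ X → isD (w (◇ X)) ≡ isP (w X)
  isD-◇ X = begin
    isD (w (◇ X))           ≡⟨ isD-¬ w-val (□ ¬ᶠ X) ⟩
    not (isD (w (□ ¬ᶠ X)))  ≡⟨ cong not (isD-□¬ X) ⟩
    not (isI (w X))         ≡⟨ sym (isP≡not-isI (w X)) ⟩
    isP (w X)               ∎

  isD-¬□ : ∀ X → isD (w (¬ᶠ □ X)) ≡ isPN (w X)
  isD-¬□ X = begin
    isD (w (¬ᶠ □ X))     ≡⟨ isD-¬ w-val (□ X) ⟩
    not (isD (w (□ X)))  ≡⟨ cong not (isD-□ w-val X) ⟩
    not (isN (w X))      ≡⟨ sym (isPN≡not-isN (w X)) ⟩
    isPN (w X)           ∎

  fromDesignated-isD : ∀ X → fromDesignated (isD ∘ w) X ≡ w X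
  fromDesignated-isD X rewrite isD-□ w-val X | isD-□¬ X = fromBits-bits (w X)

module Entailment (L : Logic) where

  Valid : Form → Set
  Valid A = ∀ w → Lvl L 0 w → isD (w A) ≡ true

  infix 4 _⊨_
  _⊨_ : Form → Form → Set
  A ⊨ B = ∀ w → Lvl L 0 w → isD (w A) ≡ true → isD (w B) ≡ true

  ⊨-refl : ∀ {A} → A ⊨ A
  ⊨-refl w w₀ DA = DA

  ⊨-trans : ∀ {A B C} → A ⊨ B → B ⊨ C → A ⊨ C
  ⊨-trans A⊨B B⊨C w w₀ = B⊨C w w₀ ∘ A⊨B w w₀

  ⊨⇒valid : ∀ {A B} → A ⊨ B → Valid (A ⇒ B)
  ⊨⇒valid A⊨B w w₀ = isD-⇒-intro (proj₁ w₀) (A⊨B w w₀)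

  ⊨-contrapose : ∀ {A B} → A ⊨ B → ¬ᶠ B ⊨ ¬ᶠ A
  ⊨-contrapose A⊨B w w₀ D¬B = isD-⇒-intro (proj₁ w₀) (isD-⇒-mp (proj₁ w₀) D¬B ∘ A⊨B w w₀)

  ⊨-¬¬ : ∀ {A} → A ⊨ ¬ᶠ ¬ᶠ A
  ⊨-¬¬ w w₀ DA = isD-⇒-intro (proj₁ w₀) (λ D¬A → isD-⇒-mp (proj₁ w₀) D¬A DA)

  ¬¬-⊨ : ∀ {A} → ¬ᶠ ¬ᶠ A ⊨ A
  ¬¬-⊨ {A} w w₀ D¬¬A with isD-excluded-middle (proj₁ w₀) A
  ... | inj₁ DA  = DA
  ... | inj₂ D¬A with () ← trans (sym (isD-⊥ (proj₁ w₀))) (isD-⇒-mp (proj₁ w₀) D¬¬A D¬A)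

  ∧-⊨ˡ : ∀ {A B} → A ∧ᶠ B ⊨ A
  ∧-⊨ˡ {A} {B} w w₀ DA∧B = ∧-conicalˡ _ _ (trans (sym (isD-∧ (proj₁ w₀) A B)) DA∧B)

  ∧-⊨ʳ : ∀ {A B} → A ∧ᶠ B ⊨ B
  ∧-⊨ʳ {A} {B} w w₀ DA∧B = ∧-conicalʳ (isD (w A)) _ (trans (sym (isD-∧ (proj₁ w₀) A B)) DA∧B)

  case-split-valid : ∀ C δ → Valid (¬ᶠ (C ∧ᶠ δ) ⇒ ¬ᶠ (C ∧ᶠ ¬ᶠ δ) ⇒ ¬ᶠ C)
  case-split-valid C δ w w₀ =
    isD-⇒-intro w-val λ ¬Cδ → isD-⇒-intro w-val λ ¬C¬δ → isD-⇒-intro w-val λ DC →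
      [ (λ Dδ  → isD-⇒-mp w-val ¬Cδ  (∧-intro DC Dδ))
      , (λ D¬δ → isD-⇒-mp w-val ¬C¬δ (∧-intro DC D¬δ))
      ]′ (isD-excluded-middle w-val δ)
    where
      w-val : IsValuation L w
      w-val = proj₁ w₀

      ∧-intro : ∀ {X Y} → isD (w X) ≡ true → isD (w Y) ≡ true → isD (w (X ∧ᶠ Y)) ≡ true
      ∧-intro {X} {Y} DX DY = trans (isD-∧ w-val X Y) (cong₂ _∧_ DX DY)

-- An enumeration of formulas

rank : Form → ℕ
rank (var n) = suc n
rank ⊥f      = 1
rank (A ⇒ B) = suc (rank A ⊔ rank B)
rank (□ A)   = suc (rank A)

formulas : ℕ → List Form
formulas zero    = []
formulas (suc k) =
  formulas k ++ ⊥f ∷ var k ∷ cartesianProductWith _⇒_ (formulas k) (formulas k) ++ mapˡ □_ (formulas k)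

formulas-mono′ : ∀ {k k′ δ} → k ≤′ k′ → δ ∈ formulas k → δ ∈ formulas k′
formulas-mono′ (≤′-reflexive refl) δ∈ = δ∈
formulas-mono′ (≤′-step k≤k′)      δ∈ = ∈-++⁺ˡ (formulas-mono′ k≤k′ δ∈)

formulas-mono : ∀ {k k′ δ} → k ≤ k′ → δ ∈ formulas k → δ ∈ formulas k′
formulas-mono = formulas-mono′ ∘ ≤⇒≤′

∈-formulas : ∀ δ → δ ∈ formulas (rank δ)
∈-formulas (var n) = ∈-++⁺ʳ (formulas n) (there (here refl))
∈-formulas ⊥f      = here refl
∈-formulas (A ⇒ B) = ∈-++⁺ʳ (formulas (rank A ⊔ rank B)) (there (there (∈-++⁺ˡ
  (∈-cartesianProductWith⁺ _⇒_ (formulas-mono (m≤m⊔n (rank A) (rank B)) (∈-formulas A))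
                               (formulas-mono (m≤n⊔m (rank A) (rank B)) (∈-formulas B))))))
∈-formulas (□ A)   = ∈-++⁺ʳ (formulas (rank A)) (there (there
  (∈-++⁺ʳ (cartesianProductWith _⇒_ (formulas (rank A)) (formulas (rank A)))
          (∈-map⁺ □_ (∈-formulas A)))))

maxRank : ∀ {m} → Vec Form m → ℕ
maxRank []       = 0
maxRank (Z ∷ Zs) = rank Z ⊔ maxRank Zs

bitFormulas : Form → Vec Form 3
bitFormulas X = X ∷ □ X ∷ □ ¬ᶠ X ∷ []

decode : ∀ {n} → Vec Bool (n * 3) → Vec TV n
decode {zero}  []               = []
decode {suc n} (a ∷ b ∷ c ∷ bs) = fromBits a b c ∷ decode bs

decode-bitFormulas : ∀ ρ {n} (Xs : Vec Form n) →
                     decode (map ρ (concat (map bitFormulas Xs))) ≡ map (fromDesignated ρ) Xs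
decode-bitFormulas ρ []       = refl
decode-bitFormulas ρ (X ∷ Xs) = cong (fromDesignated ρ X ∷_) (decode-bitFormulas ρ Xs)

-- Canonical successors

record _⇝_ (g h : Form → TV) : Set where
  field
    necessary⇒designated    : ∀ γ → isN (g γ) ≡ true → isD (h γ) ≡ true
    impossible⇒undesignated : ∀ γ → isI (g γ) ≡ true → isD (h γ) ≡ false

module Canonical {L : Logic} {g : Form → TV} (g-level : LevelValuation L g) (g-⊥ : g ⊥f ≡ vF) where
  open Entailment L

  private
    g₀ : Lvl L 0 g
    g₀ = g-level 0

    g-val : IsValuation L g
    g-val = proj₁ g₀

  valid⇒necessary : ∀ {A} → Valid A → isN (g A) ≡ true
  valid⇒necessary {A} valid = Lvl-suc-necessary 0 (g-level 1) A (λ w w₀ → ∈ᵇ⇒∈ (valid w w₀))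

  necessary-⊨ : ∀ {A B} → A ⊨ B → isN (g A) ≡ true → isN (g B) ≡ true
  necessary-⊨ A⊨B = isN-mp g-val (valid⇒necessary (⊨⇒valid A⊨B))

  isN-¬≡not-isP : ∀ A → isN (g (¬ᶠ A)) ≡ not (isP (g A))
  isN-¬≡not-isP A = trans (isN-¬ g₀ A) (isI≡not-isP (g A))

  impossible⇒necessary-¬ : ∀ {A} → isP (g A) ≡ false → isN (g (¬ᶠ A)) ≡ true
  impossible⇒necessary-¬ {A} PA = trans (isN-¬≡not-isP A) (cong not PA)

  possible-⊨ : ∀ {A B} → A ⊨ B → isP (g A) ≡ true → isP (g B) ≡ true
  possible-⊨ {A} {B} A⊨B PA with isP (g B) in PB
  ... | true  = refl
  ... | false with () ← begin
    false            ≡⟨ cong not (sym PA) ⟩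
    not (isP (g A))  ≡⟨ sym (isN-¬≡not-isP A) ⟩
    isN (g (¬ᶠ A))   ≡⟨ necessary-⊨ (⊨-contrapose A⊨B) (impossible⇒necessary-¬ PB) ⟩
    true             ∎

  inconsistent-impossible : ∀ {A} → A ⊨ ⊥f → isP (g A) ≡ true → ⊥
  inconsistent-impossible A⊨⊥ PA with () ← trans (sym (possible-⊨ A⊨⊥ PA)) (cong isP g-⊥)

  isP-¬ : ∀ A → isP (g (¬ᶠ A)) ≡ isPN (g A)
  isP-¬ A = begin
    isP (g (¬ᶠ A))           ≡⟨ isP≡not-isI (g (¬ᶠ A)) ⟩
    not (isI (g (¬ᶠ A)))     ≡⟨ cong not (sym (isN-¬ g₀ (¬ᶠ A))) ⟩
    not (isN (g (¬ᶠ ¬ᶠ A)))  ≡⟨ cong not (⇔⇒≡ (necessary-⊨ ¬¬-⊨) (necessary-⊨ ⊨-¬¬)) ⟩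
    not (isN (g A))          ≡⟨ sym (isPN≡not-isN (g A)) ⟩
    isPN (g A)               ∎

  possible-split : ∀ {C} δ → isP (g C) ≡ true → isP (g (C ∧ᶠ δ)) ≡ true ⊎ isP (g (C ∧ᶠ ¬ᶠ δ)) ≡ true
  possible-split {C} δ PC with isP (g (C ∧ᶠ δ)) in PCδ | isP (g (C ∧ᶠ ¬ᶠ δ)) in PC¬δ
  ... | true  | _     = inj₁ refl
  ... | false | true  = inj₂ refl
  ... | false | false with () ← begin
    false            ≡⟨ cong not (sym PC) ⟩
    not (isP (g C))  ≡⟨ sym (isN-¬≡not-isP C) ⟩
    isN (g (¬ᶠ C))   ≡⟨ isN-mp g-val (isN-mp g-val (valid⇒necessary (case-split-valid C δ))
                                                   (impossible⇒necessary-¬ PCδ))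
                                     (impossible⇒necessary-¬ PC¬δ) ⟩
    true             ∎

  record Extension (C : Form) (ds : List Form) : Set where
    field
      C′       : Form
      possible : isP (g C′) ≡ true
      refines  : C′ ⊨ C
      decides  : ∀ {δ} → δ ∈ ds → C′ ⊨ δ ⊎ C′ ⊨ ¬ᶠ δ

  extension-∷ : ∀ {C C₁ δ ds} → C₁ ⊨ C → C₁ ⊨ δ ⊎ C₁ ⊨ ¬ᶠ δ → Extension C₁ ds → Extension C (δ ∷ ds)
  extension-∷ C₁⊨C C₁-decides E = record
    { C′       = C′
    ; possible = possible
    ; refines  = ⊨-trans refines C₁⊨C
    ; decides  = λ { (here refl) → Sum.map (⊨-trans refines) (⊨-trans refines) C₁-decides
                   ; (there δ∈)  → decides δ∈ }
    }
    where open Extension E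

  extend : ∀ {C} → isP (g C) ≡ true → ∀ ds → Extension C ds
  extend {C} PC []       = record { C′ = C ; possible = PC ; refines = ⊨-refl ; decides = λ () }
  extend {C} PC (δ ∷ ds) with possible-split δ PC
  ... | inj₁ PCδ  = extension-∷ ∧-⊨ˡ (inj₁ ∧-⊨ʳ) (extend PCδ ds)
  ... | inj₂ PC¬δ = extension-∷ ∧-⊨ˡ (inj₂ ∧-⊨ʳ) (extend PC¬δ ds)

  module Lindenbaum {C₀ : Form} (C₀-possible : isP (g C₀) ≡ true) where

    chain : ℕ → Form
    chain-possible : ∀ k → isP (g (chain k)) ≡ true

    stage : ∀ k → Extension (chain k) (formulas k)
    stage k = extend (chain-possible k) (formulas k)

    chain zero    = C₀
    chain (suc k) = Extension.C′ (stage k)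

    chain-possible zero    = C₀-possible
    chain-possible (suc k) = Extension.possible (stage k)

    chain-⊨′ : ∀ {k k′} → k ≤′ k′ → chain k′ ⊨ chain k
    chain-⊨′ (≤′-reflexive refl)          = ⊨-refl
    chain-⊨′ {k′ = suc k′} (≤′-step k≤k′) = ⊨-trans (Extension.refines (stage k′)) (chain-⊨′ k≤k′)

    chain-⊨ : ∀ {k k′} → k ≤ k′ → chain k′ ⊨ chain k
    chain-⊨ = chain-⊨′ ∘ ≤⇒≤′

    decision : ∀ δ → chain (suc (rank δ)) ⊨ δ ⊎ chain (suc (rank δ)) ⊨ ¬ᶠ δ
    decision δ = Extension.decides (stage (rank δ)) (∈-formulas δ)

    -- The characteristic function of a maximal consistent extension of C₀.
    Δ : Form → Bool
    Δ δ with decision δ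
    ... | inj₁ _ = true
    ... | inj₂ _ = false

    chain-decides : ∀ δ {k} → rank δ < k →
                    ∀ w → Lvl L 0 w → isD (w (chain k)) ≡ true → isD (w δ) ≡ Δ δ
    chain-decides δ r<k w w₀ D with decision δ
    ... | inj₁ ⊨δ  = ⊨δ w w₀ (chain-⊨ r<k w w₀ D)
    ... | inj₂ ⊨¬δ =
      not-injective (trans (sym (isD-¬ (proj₁ w₀) δ)) (⊨¬δ w w₀ (chain-⊨ r<k w w₀ D)))

    chain-agrees : ∀ {m k} (Zs : Vec Form m) → maxRank Zs < k →
                   ∀ w → Lvl L 0 w → isD (w (chain k)) ≡ true → map (isD ∘ w) Zs ≡ map Δ Zs
    chain-agrees []       _     w w₀ D = refl
    chain-agrees (Z ∷ Zs) bound w w₀ D = cong₂ _∷_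
      (chain-decides Z (m⊔n<o⇒m<o _ _ bound) w w₀ D)
      (chain-agrees Zs (m⊔n<o⇒n<o (rank Z) _ bound) w w₀ D)

    Δ-satisfies : ∀ {m} (Zs : Vec Form m) (Q : Vec Bool m → Bool) →
                  (∀ w → Lvl L 0 w → Q (map (isD ∘ w) Zs) ≡ true) → Q (map Δ Zs) ≡ true
    -- Were Q to fail at Δ, the stage of the chain deciding all of Zs would entail ⊥f.
    Δ-satisfies Zs Q valid with Q (map Δ Zs) in QΔ
    ... | true  = refl
    ... | false = ⊥-elim (inconsistent-impossible chain⊨⊥ (chain-possible (suc (maxRank Zs))))
      where
        chain⊨⊥ : chain (suc (maxRank Zs)) ⊨ ⊥f
        chain⊨⊥ w w₀ D
          with () ← trans (sym (valid w w₀)) (trans (cong Q (chain-agrees Zs ≤-refl w w₀ D)) QΔ)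

    ⊨⇒Δ : ∀ δ {k} → rank δ < k → chain k ⊨ δ → Δ δ ≡ true
    ⊨⇒Δ δ {k} r<k chain⊨δ with Δ δ in Δδ
    ... | true  = refl
    ... | false = ⊥-elim (inconsistent-impossible chain⊨⊥ (chain-possible k))
      where
        chain⊨⊥ : chain k ⊨ ⊥f
        chain⊨⊥ w w₀ D
          with () ← trans (sym (chain⊨δ w w₀ D)) (trans (chain-decides δ r<k w w₀ D) Δδ)

    Δ-C₀ : Δ C₀ ≡ true
    Δ-C₀ = ⊨⇒Δ C₀ ≤-refl (chain-⊨ {k′ = suc (rank C₀)} z≤n)

    refuted⇒⊨¬ : ∀ δ → Δ δ ≡ false → chain (suc (rank δ)) ⊨ ¬ᶠ δ
    refuted⇒⊨¬ δ Δδ w w₀ D =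
      trans (isD-¬ (proj₁ w₀) δ) (cong not (trans (chain-decides δ ≤-refl w w₀ D) Δδ))

    necessary⇒Δ : ∀ {Z} → isN (g Z) ≡ true → Δ Z ≡ true
    necessary⇒Δ {Z} NZ with Δ Z in ΔZ
    ... | true  = refl
    ... | false with () ← begin
      false            ≡⟨ sym (cong not NZ) ⟩
      not (isN (g Z))  ≡⟨ sym (isPN≡not-isN (g Z)) ⟩
      isPN (g Z)       ≡⟨ sym (isP-¬ Z) ⟩
      isP (g (¬ᶠ Z))   ≡⟨ possible-⊨ (refuted⇒⊨¬ Z ΔZ) (chain-possible (suc (rank Z))) ⟩
      true             ∎

    Δ-valuation : Form → TV
    Δ-valuation = fromDesignated Δ

    Δ-valuation-satisfies : ∀ {n} (Xs : Vec Form n) (f : Vec TV n → Bool) →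
                            (∀ w → Lvl L 0 w → f (map w Xs) ≡ true) → f (map Δ-valuation Xs) ≡ true
    Δ-valuation-satisfies Xs f valid =
      subst (λ vs → f vs ≡ true) (decode-bitFormulas Δ Xs)
        (Δ-satisfies (concat (map bitFormulas Xs)) (f ∘ decode) λ w w₀ →
          subst (λ vs → f vs ≡ true)
                (sym (trans (decode-bitFormulas (isD ∘ w) Xs) (map-cong (fromDesignated-isD w₀) Xs)))
                (valid w w₀))

    Δ-valuation-isValuation : IsValuation L Δ-valuation
    Δ-valuation-isValuation = record
      { inV = λ β → ∈ᵇ⇒∈ (Δ-valuation-satisfies (β ∷ []) (λ { (a ∷ []) → a ∈ᵇ V L })
                            (λ w w₀ → ∈⇒∈ᵇ (IsValuation.inV (proj₁ w₀) β)))
      ; bot = ∈ᵇ⇒∈ (Δ-valuation-satisfies (⊥f ∷ []) (λ { (a ∷ []) → a ∈ᵇ bot~ })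
                      (λ w w₀ → ∈⇒∈ᵇ (IsValuation.bot (proj₁ w₀))))
      ; imp = λ β γ → ∈ᵇ⇒∈ (Δ-valuation-satisfies (β ∷ γ ∷ (β ⇒ γ) ∷ [])
                                (λ { (a ∷ b ∷ c ∷ []) → c ∈ᵇ imp~ a b })
                                (λ w w₀ → ∈⇒∈ᵇ (IsValuation.imp (proj₁ w₀) β γ)))
      ; box = λ β → ∈ᵇ⇒∈ (Δ-valuation-satisfies (β ∷ □ β ∷ [])
                            (λ { (a ∷ b ∷ []) → b ∈ᵇ box~ L a })
                            (λ w w₀ → ∈⇒∈ᵇ (IsValuation.box (proj₁ w₀) β)))
      }

    Δ-valuation-level : LevelValuation L Δ-valuation
    Δ-valuation-level zero    = Δ-valuation-isValuation , λ β trivial-β γ →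
      ∈ᵇ⇒∈ (⇒ᵇ-mp (Δ-valuation-satisfies (β ∷ γ ∷ [])
                                          (λ { (a ∷ b ∷ []) → trivial a ⇒ᵇ trivial b })
                                          (λ w w₀ → ⇒ᵇ-intro (trivial-spreads w₀ β γ)))
                  (∈⇒∈ᵇ trivial-β))
    Δ-valuation-level (suc n) = Δ-valuation-level n , λ β designated →
      subst₂ (λ a b → fromBits a b (Δ (□ ¬ᶠ β)) ∈ vT ∷ vt₂ ∷ [])
             (sym (necessary⇒Δ (Lvl-suc-necessary n (g-level (suc n)) β designated)))
             (sym (necessary⇒Δ (Lvl-suc-necessary (suc n) (g-level (suc (suc n))) (□ β) λ w wₛ →
               ∈ᵇ⇒∈ (trans (isD-□ (proj₁ (Lvl-base (suc n) wₛ)) β)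
                           (Lvl-suc-necessary n wₛ β designated)))))
             (fromBits-necessary (Δ (□ ¬ᶠ β)))

    g⇝Δ-valuation : g ⇝ Δ-valuation
    g⇝Δ-valuation = record
      { necessary⇒designated    = λ γ Nγ → trans (isD-fromBits _ _ _) (necessary⇒Δ Nγ)
      ; impossible⇒undesignated = λ γ Iγ → not-injective (begin
          not (isD (Δ-valuation γ))  ≡⟨ sym (isD-¬ Δ-valuation-isValuation γ) ⟩
          isD (Δ-valuation (¬ᶠ γ))   ≡⟨ isD-fromBits _ _ _ ⟩
          Δ (¬ᶠ γ)                   ≡⟨ necessary⇒Δ (trans (isN-¬ g₀ γ) Iγ) ⟩
          true                       ∎)
      }

successor : ∀ {L g C} → LevelValuation L g → g ⊥f ≡ vF → isP (g C) ≡ true →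
            Σ (Form → TV) λ h → LevelValuation L h × g ⇝ h × isD (h C) ≡ true
successor g-level g-⊥ PC =
  Δ-valuation , Δ-valuation-level , g⇝Δ-valuation , trans (isD-fromBits _ _ _) Δ-C₀
  where open Canonical.Lindenbaum g-level g-⊥ PC

-- Frame conditions along canonical edges

module Edge {L : Logic} {g h : Form → TV} (g₀ : Lvl L 0 g) (h₀ : Lvl L 0 h) (g⇝h : g ⇝ h) where
  open _⇝_ g⇝h

  private
    g-val : IsValuation L g
    g-val = proj₁ g₀

    h-val : IsValuation L h
    h-val = proj₁ h₀

  source-⊥ : g ⊥f ≡ vF
  source-⊥ with g ⊥f in ⊥≡ | IsValuation.bot g-val
  ... | .vF  | here refl         = refl
  ... | .vf₂ | there (here refl)
    with () ← trans (sym (necessary⇒designated ⊥f (cong isN ⊥≡))) (isD-⊥ h-val)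

  designated⇒possible : ∀ X → isD (h X) ≡ true → isP (g X) ≡ true
  designated⇒possible X DX with isI (g X) in IX
  ... | true  with () ← trans (sym DX) (impossible⇒undesignated X IX)
  ... | false = trans (isP≡not-isI (g X)) (cong not IX)

  forces : ∀ {p c} → Forces L p c → ∀ X → p (g X) ≡ true → isD (h (c [ X ])) ≡ true
  forces {c = c} table X pX = necessary⇒designated (c [ X ]) (all-∈ isN
    (forces-necessary table (IsValuation.inV g-val X) (⊥≡F⇒nontrivial g₀ source-⊥ X) pX)
    (value∈values g-val source-⊥ c X))

  at-source-□ : ∀ {f} → BoxValues L f → ∀ X → f (g (□ X)) ≡ true
  at-source-□ table X = box-values table (IsValuation.inV g-val X) (⊥≡F⇒nontrivial g₀ source-⊥ X)
                                         (value∈values g-val source-⊥ (□ᶜ ∙) X)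

  B-designated : HasB L → ∀ X → isD (g X) ≡ true → isP (h X) ≡ true
  B-designated hB X DX = trans (sym (isD-◇ h₀ X)) (forces (proj₁ (B-table hB)) X DX)

  B-undesignated : HasB L → ∀ X → isD (g X) ≡ false → isPN (h X) ≡ true
  B-undesignated hB X ¬DX = trans (sym (isD-¬□ h₀ X)) (forces (proj₂ (B-table hB)) X (cong not ¬DX))

  4-necessary : Has4 L → ∀ X → isN (g X) ≡ true → isN (h X) ≡ true
  4-necessary h4 X NX = trans (sym (isD-□ h-val X)) (forces (proj₁ (4-table h4)) X NX)

  4-impossible : Has4 L → ∀ X → isI (g X) ≡ true → isI (h X) ≡ true
  4-impossible h4 X IX = trans (sym (isD-□¬ h₀ X)) (forces (proj₂ (4-table h4)) X IX)

  5-possible : Has5 L → ∀ X → isP (g X) ≡ true → isP (h X) ≡ true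
  5-possible h5 X PX = trans (sym (isD-◇ h₀ X)) (forces (5-Tables.possible⇒□◇ (5-table h5)) X PX)

  5-possibly-not : Has5 L → ∀ X → isPN (g X) ≡ true → isPN (h X) ≡ true
  5-possibly-not h5 X PNX =
    trans (sym (isD-¬□ h₀ X)) (forces (5-Tables.possibly-not⇒□¬□ (5-table h5)) X PNX)

  5-necessary-target : Has5 L → ∀ X → isN (h X) ≡ isN (g (□ X))
  5-necessary-target h5 X = ⇔⇒≡
    (λ NhX → ⇒ᵇ-mp (at-source-□ (5-Tables.□-possible⇒necessary (5-table h5)) X)
                   (designated⇒possible (□ X) (trans (isD-□ h-val X) NhX)))
    (λ Ng□X → trans (sym (isD-□ h-val X)) (necessary⇒designated (□ X) Ng□X))

5-necessary-successor : ∀ {L g′ g h} → Has5 L → Lvl L 0 g′ → Lvl L 0 g → Lvl L 0 h → g′ ⇝ g → g ⇝ h →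
                        ∀ X → isN (g (□ X)) ≡ isN (g X)
5-necessary-successor {g = g} h5 g′₀ g₀ h₀ g′⇝g g⇝h X = ⇔⇒≡
  (λ Ng□X → trans (sym (isD-□ (proj₁ g₀) X)) (⇒ᵇ-mp (out.at-source-□ □-necessary⇒designated X) Ng□X))
  (λ NgX → ⇒ᵇ-mp (out.at-source-□ □-possible⇒necessary X) (begin
    isP (g (□ X))    ≡⟨ sym (isD-◇ g₀ (□ X)) ⟩
    isD (g (◇ □ X))  ≡⟨ into.forces possible⇒□◇ (□ X) (into.designated⇒possible (□ X)
                                                        (trans (isD-□ (proj₁ g₀) X) NgX)) ⟩
    true             ∎))
  where
    module into = Edge g′₀ g₀ g′⇝g
    module out  = Edge g₀ h₀ g⇝h
    open 5-Tables (5-table h5)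

-- The model generated by v

restrict-partial : ∀ {L g} (Λ : Form → Set) → IsValuation L g → IsPartialValuation L Λ (restrict Λ g)
restrict-partial Λ g-val = record
  { inV = λ β _ → inV β
  ; bot = λ _ → bot
  ; imp = λ β γ _ _ _ → imp β γ
  ; box = λ β _ _ → box β
  }
  where open IsValuation g-val

module Model (L : Logic) (v : Form → TV) (v-level : LevelValuation L v) (Λ : Form → Set) where

  data Reachable : (Form → TV) → Set where
    root : Reachable v
    step : ∀ {g h} → Reachable g → LevelValuation L h → g ⇝ h → Reachable h

  reachable-level : ∀ {g} → Reachable g → LevelValuation L g
  reachable-level root               = v-level
  reachable-level (step _ h-level _) = h-level

  Π : PMap Λ → Set
  Π u = Σ (Form → TV) λ g → Reachable g × u ≡ restrict Λ g

  record R (u w : PMap Λ) : Set where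
    constructor edge
    field
      {source target}  : Form → TV
      source-reachable : Reachable source
      target-level     : LevelValuation L target
      accessible       : source ⇝ target
      u≡source         : u ≡ restrict Λ source
      w≡target         : w ≡ restrict Λ target

  5-via-root : Has5 L → ∀ {g h} → Reachable g → Lvl L 0 h → g ⇝ h → ∀ X → isN (h X) ≡ isN (v (□ X))
  5-via-root h5 root h₀ v⇝h X = Edge.5-necessary-target (v-level 0) h₀ v⇝h h5 X
  5-via-root h5 {g} {h} (step rg′ g-level g′⇝g) h₀ g⇝h X = begin
    isN (h X)      ≡⟨ Edge.5-necessary-target (g-level 0) h₀ g⇝h h5 X ⟩
    isN (g (□ X))  ≡⟨ 5-necessary-successor h5 (reachable-level rg′ 0) (g-level 0) h₀ g′⇝g g⇝h X ⟩
    isN (g X)      ≡⟨ 5-via-root h5 rg′ (g-level 0) g′⇝g X ⟩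
    isN (v (□ X))  ∎

  5-targets-necessary : Has5 L → ∀ {a b c d} → R a b → R c d → ∀ β (p : Λ β) → isN (b β p) ≡ isN (d β p)
  5-targets-necessary h5 (edge rg₁ l₁ g₁⇝h₁ _ refl) (edge rg₂ l₂ g₂⇝h₂ _ refl) β p =
    trans (5-via-root h5 rg₁ (l₁ 0) g₁⇝h₁ β) (sym (5-via-root h5 rg₂ (l₂ 0) g₂⇝h₂ β))

  5-targets-impossible : Has5 L → ∀ {a b c d} → R a b → R c d → ∀ β (p : Λ β) → isI (b β p) ≡ isI (d β p)
  5-targets-impossible h5 (edge {target = h₁} rg₁ l₁ g₁⇝h₁ _ refl)
                          (edge {target = h₂} rg₂ l₂ g₂⇝h₂ _ refl) β p = begin
      isI (h₁ β)        ≡⟨ sym (isN-¬ (l₁ 0) β) ⟩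
      isN (h₁ (¬ᶠ β))   ≡⟨ 5-via-root h5 rg₁ (l₁ 0) g₁⇝h₁ (¬ᶠ β) ⟩
      isN (v (□ ¬ᶠ β))  ≡⟨ sym (5-via-root h5 rg₂ (l₂ 0) g₂⇝h₂ (¬ᶠ β)) ⟩
      isN (h₂ (¬ᶠ β))   ≡⟨ isN-¬ (l₂ 0) β ⟩
      isI (h₂ β)        ∎

  successor-world : ∀ {g C} → Reachable g → g ⊥f ≡ vF → isP (g C) ≡ true →
                    Σ (Form → TV) λ h → LevelValuation L h × Π (restrict Λ h) ×
                                        R (restrict Λ g) (restrict Λ h) × isD (h C) ≡ true
  successor-world rg g-⊥ PC with successor (reachable-level rg) g-⊥ PC
  ... | h , h-level , g⇝h , DhC =
    h , h-level , (h , step rg h-level g⇝h , refl) , edge rg h-level g⇝h refl refl , DhC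

  pre-P : ∀ u → Π u → ∀ β (p : Λ β) → u β p ∈ P → Σ (PMap Λ) λ w → Π w × R u w × w β p ∈ 𝒟
  pre-P _ (g , rg , refl) β _ Pβ =
    let h , _ , Πh , g→h , Dhβ = successor-world rg g-⊥ (∈⇒∈ᵇ Pβ)
    in  restrict Λ h , Πh , g→h , ∈ᵇ⇒∈ Dhβ
    where
      g-⊥ : g ⊥f ≡ vF
      g-⊥ = nontrivial⇒⊥≡F (reachable-level rg 0) β (isP⇒nontrivial (g β) (∈⇒∈ᵇ Pβ))

  pre-PN : ∀ u → Π u → ∀ β (p : Λ β) → u β p ∈ PN → Σ (PMap Λ) λ w → Π w × R u w × ¬ (w β p ∈ 𝒟)
  pre-PN _ (g , rg , refl) β _ PNβ =
    let h , h-level , Πh , g→h , Dh¬β = successor-world rg g-⊥ P¬β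
    in  restrict Λ h , Πh , g→h ,
        ∈ᵇ≡false⇒∉ (not-injective (trans (sym (isD-¬ (proj₁ (h-level 0)) β)) Dh¬β))
    where
      g-⊥ : g ⊥f ≡ vF
      g-⊥ = nontrivial⇒⊥≡F (reachable-level rg 0) β (isPN⇒nontrivial (g β) (∈⇒∈ᵇ PNβ))

      P¬β : isP (g (¬ᶠ β)) ≡ true
      P¬β = trans (Canonical.isP-¬ (reachable-level rg) g-⊥ β) (∈⇒∈ᵇ PNβ)

  world-condition : ∀ A B → OnValues L (λ x → x ∈ᵇ A ⇒ᵇ x ∈ᵇ B) →
                    ∀ u → Π u → ∀ β (p : Λ β) → u β p ∈ A → u β p ∈ B
  world-condition A B table _ (_ , rg , refl) β _ x∈A =
    ∈ᵇ⇒∈ (⇒ᵇ-mp (on-values table (IsValuation.inV (proj₁ (reachable-level rg 0)) β)) (∈⇒∈ᵇ x∈A))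

  edge-condition : ∀ A B →
                   (∀ {g h} → Lvl L 0 g → Lvl L 0 h → g ⇝ h → ∀ β → g β ∈ᵇ A ≡ true → h β ∈ᵇ B ≡ true) →
                   ∀ u w → R u w → ∀ β (p : Λ β) → u β p ∈ A → w β p ∈ B
  edge-condition A B holds _ _ (edge rg h-level g⇝h refl refl) β _ x∈A =
    ∈ᵇ⇒∈ (holds (reachable-level rg 0) (h-level 0) g⇝h β (∈⇒∈ᵇ x∈A))

  model : IsLModel L Λ Π R
  model = record
    { Π-partial = λ { _ (_ , rg , refl) → restrict-partial Λ (proj₁ (reachable-level rg 0)) }
    ; R-dom     = λ { _ _ (edge rg _ _ u≡g _) → _ , rg , u≡g }
    ; R-cod     = λ { _ _ (edge rg h-level g⇝h _ w≡h) → _ , step rg h-level g⇝h , w≡h }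
    ; pre-P     = pre-P
    ; pre-PN    = pre-PN
    ; K-N       = edge-condition N 𝒟 λ _ _ g⇝h → _⇝_.necessary⇒designated g⇝h
    ; K-I       = λ { _ _ (edge _ _ g⇝h refl refl) β _ Iβ →
                      ∈ᵇ≡false⇒∉ (_⇝_.impossible⇒undesignated g⇝h β (∈⇒∈ᵇ Iβ)) }
    ; T-N       = λ hT → world-condition N 𝒟 (proj₁ (T-table hT))
    ; T-I       = λ { hT _ (_ , rg , refl) β _ Iβ → ∈ᵇ≡false⇒∉ (not-injective
                      (⇒ᵇ-mp (on-values (proj₂ (T-table hT)) (IsValuation.inV (proj₁ (reachable-level rg 0)) β))
                             (∈⇒∈ᵇ Iβ))) }
    ; D-N       = λ hD → world-condition N P (proj₁ (D-table hD))
    ; D-I       = λ hD → world-condition I PN (proj₂ (D-table hD))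
    ; B-D       = λ hB → edge-condition 𝒟 P λ g₀ h₀ g⇝h → Edge.B-designated g₀ h₀ g⇝h hB
    ; B-nD      = λ { hB _ _ (edge rg h-level g⇝h refl refl) β _ ¬Dβ →
                      ∈ᵇ⇒∈ (Edge.B-undesignated (reachable-level rg 0) (h-level 0) g⇝h hB β
                                                (∉⇒∈ᵇ≡false ¬Dβ)) }
    ; 4-N       = λ h4 → edge-condition N N λ g₀ h₀ g⇝h → Edge.4-necessary g₀ h₀ g⇝h h4
    ; 4-I       = λ h4 → edge-condition I I λ g₀ h₀ g⇝h → Edge.4-impossible g₀ h₀ g⇝h h4
    ; 5-P       = λ h5 → edge-condition P P λ g₀ h₀ g⇝h → Edge.5-possible g₀ h₀ g⇝h h5
    ; 5-PN      = λ h5 → edge-condition PN PN λ g₀ h₀ g⇝h → Edge.5-possibly-not g₀ h₀ g⇝h h5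
    ; 5-N       = λ { h5 _ _ _ _ r (inj₁ r′) β p _ Nβ → transfer (5-targets-necessary h5 r r′ β p) Nβ
                    ; h5 _ _ _ _ r (inj₂ r′) β p _ Nβ → transfer (5-targets-necessary h5 r r′ β p) Nβ }
    ; 5-I       = λ { h5 _ _ _ _ r (inj₁ r′) β p _ Iβ → transfer (5-targets-impossible h5 r r′ β p) Iβ
                    ; h5 _ _ _ _ r (inj₂ r′) β p _ Iβ → transfer (5-targets-impossible h5 r r′ β p) Iβ }
    }
    where
      transfer : ∀ {x y A} → x ∈ᵇ A ≡ y ∈ᵇ A → x ∈ A → y ∈ A
      transfer same x∈A = ∈ᵇ⇒∈ (trans (sym same) (∈⇒∈ᵇ x∈A))

theorem6 : (L : Logic) (v : Form → TV) → LevelValuation L v →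
           (Λ : Form → Set) → SubformulaClosed Λ →
           PartialLevelValuation L Λ (restrict Λ v)
theorem6 L v v-level Λ _ = Π , R , model , v , root , refl
  where open Model L v v-level Λ
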